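{- Let $\sigma\ge2$ be an even integer. Then $z(w_\sigma)=2\sigma+\sigma/2-2$.
   Context: Let $\Sigma=\{a_1,\dots,a_\sigma\}$ with $a_1<\cdots<a_\sigma$, and $w_\sigma=\left(\prod_{i=1}^{\sigma-1}a_ia_{i+1}\right)\left(\prod_{i=1}^{\sigma}a_i\right)$ (concatenation in increasing $i$), so $|w_\sigma|=3\sigma-2$. The Lempel–Ziv parse of a string $w$ is the factorization $w=x_1\cdots x_z$ in which each phrase $x_j$ is the longest prefix of $x_j\cdots x_z$ having another occurrence in $w$ starting at a position $i\le|x_1\cdots x_{j-1}|$ (overlaps allowed), or a single character if no nonempty such prefix exists; $z(w)$ is the number of phrases. -}

module Defs where

open import Data.Nat using (ℕ; zero; suc; _+_; _<_)
open import Data.List using (List; []; _∷_; _++_; length; drop; map; upTo; concat)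
open import Data.Product using (Σ; ∃; _×_)
open import Data.Sum using (_⊎_)
open import Relation.Binary.PropositionalEquality using (_≡_)
open import Relation.Nullary using (¬_)

-- Strings over an ordered alphabet: we encode the letter a_i as the natural
-- number i (so a_1 < ... < a_σ is 1 < ... < σ).
Str : Set
Str = List ℕ

-- w_σ = (a_1 a_2)(a_2 a_3)...(a_{σ-1} a_σ) a_1 a_2 ... a_σ
pairsPart : ℕ → Str
pairsPart σ = concat (map (λ i → suc i ∷ suc (suc i) ∷ []) (upTo (pred' σ)))
  where
  pred' : ℕ → ℕ
  pred' zero = zero
  pred' (suc n) = n

lettersPart : ℕ → Str
lettersPart σ = map suc (upTo σ)

wσ : ℕ → Str
wσ σ = pairsPart σ ++ lettersPart σ

IsPrefix : Str → Str → Set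
IsPrefix x u = ∃ λ t → u ≡ x ++ t

-- x has an occurrence in w starting at a 0-indexed position i < s
-- (i.e. 1-indexed position i+1 ≤ s = |x_1 ⋯ x_{j-1}|); overlaps allowed.
OccursBefore : Str → ℕ → Str → Set
OccursBefore w s x = ∃ λ i → (i < s) × IsPrefix x (drop i w)

LZPhrase : Str → ℕ → Str → Set
LZPhrase w s x =
  IsPrefix x (drop s w) ×
  ( ( (0 < length x) × OccursBefore w s x ×
      (∀ y → IsPrefix y (drop s w) → length x < length y → ¬ OccursBefore w s y) )
  ⊎ ( (∀ y → IsPrefix y (drop s w) → 0 < length y → ¬ OccursBefore w s y) ×
      (length x ≡ 1) ) )

data LZFrom (w : Str) : ℕ → List Str → Set where
  end  : LZFrom w (length w) []
  cons : ∀ {s x xs} → LZPhrase w s x → LZFrom w (s + length x) xs → LZFrom w s (x ∷ xs)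

IsLZParse : Str → List Str → Set
IsLZParse w xs = LZFrom w 0 xs

-- z(w) = n : the LZ parse of w exists and every LZ parse of w has n phrases
-- (the parse is unique, so this says exactly z(w) = n).
LZCount : Str → ℕ → Set
LZCount w n = (Σ (List Str) λ xs → IsLZParse w xs × length xs ≡ n)
            × (∀ xs → IsLZParse w xs → length xs ≡ n)

{-# OPTIONS --safe #-}
module Submission where

open import Defs
open import Data.Nat
  using (ℕ; zero; suc; _+_; _*_; _∸_; _/_; _≤_; _<_; z≤n; s≤s; s≤s⁻¹; _<?_; ⌊_/2⌋; ⌈_/2⌉)
open import Data.Nat.Divisibility using (_∣_; divides)
open import Data.Nat.DivMod using (m*n/n≡m)
open import Data.Nat.Properties
  using ( ≤-refl; ≤-trans; <-trans; ≤-<-trans; <-≤-trans; <⇒≤; <⇒≢; ≤⇒≯; ≮⇒≥; <-cmp; n<1+n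
        ; m≤n⇒m<n∨m≡n; suc-injective; 0≢1+n; 1+n≢n; +-identityʳ; +-suc; +-comm; *-comm
        ; m≤n+m; m<n+m; m+n≤o⇒n≤o; m∸n+n≡m; +-monoˡ-≤; +-monoʳ-≤; +-cancelʳ-≤; +-cancelʳ-<
        ; ⌈n/2⌉-mono; module ≤-Reasoning)
open import Data.List using (List; []; _∷_; _++_; length; drop; map; concat; applyUpTo; upTo)
open import Data.List.Properties
  using (∷-injectiveˡ; ∷-injectiveʳ; length-++; length-++-≤ˡ; length-map; length-upTo; map-applyUpTo)
open import Data.Product using (Σ; _×_; _,_; proj₁)
open import Data.Sum using (inj₁; inj₂)
open import Data.Empty using (⊥-elim)
open import Relation.Nullary using (¬_; yes; no)
open import Relation.Binary using (tri<; tri≈; tri>)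
open import Relation.Binary.PropositionalEquality
  using (_≡_; _≢_; refl; sym; trans; cong; cong₂; subst; module ≡-Reasoning)

-- Write σ = m + 1.  The pair part 1 2 2 3 3 4 … m m+1 of w_σ has the letter ⌈i/2⌉ + 1 at
-- position i, so it is non-decreasing: the letter j + 2 first appears at position 2j + 1,
-- and the digram (j+2)(j+3) first at 2j + 2.  Hence the pair part parses as 1 | 2 | 2 | 3 | …,
-- a copied and a fresh letter per pair, 2m phrases.  Every digram (q+1)(q+2) of the final
-- run 1 2 … σ already occurs in the pair part, but the trigram (q+1)(q+2)(q+3) occurs nowhere
-- before position 2m + q (the pair part has no ascending trigram), so the run parses into
-- σ/2 digrams.  The LZ parse is unique, so z(w_σ) = 2m + σ/2 = 2σ + σ/2 − 2.

-- Junk value 0 past the end.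
nth : Str → ℕ → ℕ
nth []      _       = 0
nth (c ∷ _) zero    = c
nth (_ ∷ w) (suc i) = nth w i

nth-++ˡ : ∀ xs ys {i} → i < length xs → nth (xs ++ ys) i ≡ nth xs i
nth-++ˡ (_ ∷ _)  _  {zero}  _         = refl
nth-++ˡ (_ ∷ xs) ys {suc i} (s≤s i<n) = nth-++ˡ xs ys i<n

nth-++ʳ : ∀ xs ys q → nth (xs ++ ys) (length xs + q) ≡ nth ys q
nth-++ʳ []       _  _ = refl
nth-++ʳ (_ ∷ xs) ys q = nth-++ʳ xs ys q

nth-applyUpTo : ∀ (f : ℕ → ℕ) {n q} → q < n → nth (applyUpTo f n) q ≡ f q
nth-applyUpTo f {suc n} {zero}  _         = refl
nth-applyUpTo f {suc n} {suc q} (s≤s q<n) = nth-applyUpTo (λ k → f (suc k)) q<n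

drop-nth : ∀ w {i} → i < length w → drop i w ≡ nth w i ∷ drop (suc i) w
drop-nth (_ ∷ _) {zero}  _         = refl
drop-nth (_ ∷ w) {suc i} (s≤s i<n) = drop-nth w i<n

IsPrefix-∷-drop : ∀ w i {c y} → IsPrefix (c ∷ y) (drop i w) → nth w i ≡ c × IsPrefix y (drop (suc i) w)
IsPrefix-∷-drop []      zero    (_ , ())
IsPrefix-∷-drop []      (suc _) (_ , ())
IsPrefix-∷-drop (_ ∷ _) zero    (t , refl) = refl , (t , refl)
IsPrefix-∷-drop (_ ∷ w) (suc i) py         = IsPrefix-∷-drop w i py

IsPrefix-drop-length : ∀ w i {y} → IsPrefix y (drop i w) → 0 < length y → length y + i ≤ length w
IsPrefix-drop-length w       zero    {y}     (t , refl) _ =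
  subst (_≤ length (y ++ t)) (sym (+-identityʳ (length y))) (length-++-≤ˡ y)
IsPrefix-drop-length []      (suc i) {[]}    _          ()
IsPrefix-drop-length []      (suc i) {_ ∷ _} (_ , ())   _
IsPrefix-drop-length (_ ∷ w) (suc i) {y}     py         0<y =
  subst (_≤ suc (length w)) (sym (+-suc (length y) i)) (s≤s (IsPrefix-drop-length w i py 0<y))

-- A genuine factor of w only when n + i ≤ length w; past the end it is padded with 0.
factor : Str → ℕ → ℕ → Str
factor w i zero    = []
factor w i (suc n) = nth w i ∷ factor w (suc i) n

length-factor : ∀ w i n → length (factor w i n) ≡ n
length-factor w i zero    = refl
length-factor w i (suc n) = cong suc (length-factor w (suc i) n)

factor-IsPrefix : ∀ w i n → n + i ≤ length w → IsPrefix (factor w i n) (drop i w)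
factor-IsPrefix w i zero    _         = drop i w , refl
factor-IsPrefix w i (suc n) 1+n+i≤|w| = prepend (factor-IsPrefix w (suc i) n n+1+i≤|w|)
  where
  n+1+i≤|w| : n + suc i ≤ length w
  n+1+i≤|w| = subst (_≤ length w) (sym (+-suc n i)) 1+n+i≤|w|
  prepend : IsPrefix (factor w (suc i) n) (drop (suc i) w) → IsPrefix (factor w i (suc n)) (drop i w)
  prepend (t , eq) = t , trans (drop-nth w (m+n≤o⇒n≤o n n+1+i≤|w|)) (cong (nth w i ∷_) eq)

IsPrefix⇒factor : ∀ w i y → IsPrefix y (drop i w) → y ≡ factor w i (length y)
IsPrefix⇒factor w i []      _  = refl
IsPrefix⇒factor w i (c ∷ y) py with IsPrefix-∷-drop w i py
... | nth≡c , py′ = cong₂ _∷_ (sym nth≡c) (IsPrefix⇒factor w (suc i) y py′)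

factor-shorten : ∀ {w i j n k} → n ≤ k → factor w i k ≡ factor w j k → factor w i n ≡ factor w j n
factor-shorten z≤n       _  = refl
factor-shorten (s≤s n≤k) eq = cong₂ _∷_ (∷-injectiveˡ eq) (factor-shorten n≤k (∷-injectiveʳ eq))

IsPrefix-unique : ∀ w s {x x′} → IsPrefix x (drop s w) → IsPrefix x′ (drop s w) →
                  length x ≡ length x′ → x ≡ x′
IsPrefix-unique w s {x} {x′} px px′ |x|≡|x′| =
  trans (IsPrefix⇒factor w s x px) (trans (cong (factor w s) |x|≡|x′|) (sym (IsPrefix⇒factor w s x′ px′)))

LZPhrase-nonempty : ∀ {w s x} → LZPhrase w s x → 0 < length x
LZPhrase-nonempty (_ , inj₁ (0<|x| , _))  = 0<|x|
LZPhrase-nonempty (_ , inj₂ (_ , |x|≡1)) = subst (0 <_) (sym |x|≡1) (s≤s z≤n)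

LZPhrase-unique : ∀ {w s x x′} → LZPhrase w s x → LZPhrase w s x′ → x ≡ x′
LZPhrase-unique {w} {s} {x} {x′} (px , inj₁ (_ , ox , longest)) (px′ , inj₁ (_ , ox′ , longest′))
  with <-cmp (length x) (length x′)
... | tri< x<x′ _ _ = ⊥-elim (longest x′ px′ x<x′ ox′)
... | tri≈ _ x≡x′ _ = IsPrefix-unique w s px px′ x≡x′
... | tri> _ _ x′<x = ⊥-elim (longest′ x px x′<x ox)
LZPhrase-unique (px , inj₁ (0<|x| , ox , _)) (_ , inj₂ (unseen′ , _)) = ⊥-elim (unseen′ _ px 0<|x| ox)
LZPhrase-unique (_ , inj₂ (unseen , _)) (px′ , inj₁ (0<|x′| , ox′ , _)) = ⊥-elim (unseen _ px′ 0<|x′| ox′)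
LZPhrase-unique {w} {s} (px , inj₂ (_ , |x|≡1)) (px′ , inj₂ (_ , |x′|≡1)) =
  IsPrefix-unique w s px px′ (trans |x|≡1 (sym |x′|≡1))

¬LZPhrase-at-end : ∀ {w x} → ¬ LZPhrase w (length w) x
¬LZPhrase-at-end {w} {x} phrase@(px , _) =
  ≤⇒≯ (IsPrefix-drop-length w (length w) px 0<|x|) (m<n+m (length w) 0<|x|)
  where
  0<|x| : 0 < length x
  0<|x| = LZPhrase-nonempty phrase

LZFrom-unique : ∀ {w s xs ys} → LZFrom w s xs → LZFrom w s ys → xs ≡ ys
LZFrom-unique end           end             = refl
LZFrom-unique end           (cons x′ _)     = ⊥-elim (¬LZPhrase-at-end x′)
LZFrom-unique (cons x _)    end             = ⊥-elim (¬LZPhrase-at-end x)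
LZFrom-unique (cons x rest) (cons x′ rest′) with LZPhrase-unique x x′
... | refl = cong (_ ∷_) (LZFrom-unique rest rest′)

Parse : Str → ℕ → ℕ → Set
Parse w s n = Σ (List Str) λ xs → LZFrom w s xs × length xs ≡ n

parse-end : ∀ {w} → Parse w (length w) 0
parse-end = [] , end , refl

parse-cons : ∀ {w s t x n} → LZPhrase w s x → s + length x ≡ t → Parse w t n → Parse w s (suc n)
parse-cons phrase refl (xs , rest , |xs|≡n) = _ ∷ xs , cons phrase rest , cong suc |xs|≡n

LZCount-of-parse : ∀ {w n} → Parse w 0 n → LZCount w n
LZCount-of-parse (xs , parse , |xs|≡n) =
  (xs , parse , |xs|≡n) , λ ys parse′ → trans (cong length (LZFrom-unique parse′ parse)) |xs|≡n

LZPhrase-fresh : ∀ {w s} → s < length w → (∀ i → i < s → nth w i ≢ nth w s) →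
                 LZPhrase w s (nth w s ∷ [])
LZPhrase-fresh {w} {s} s<|w| fresh = factor-IsPrefix w s 1 s<|w| , inj₂ (unseen , refl)
  where
  unseen : ∀ y → IsPrefix y (drop s w) → 0 < length y → ¬ OccursBefore w s y
  unseen (_ ∷ _) py _ (i , i<s , pyi) =
    fresh i i<s (trans (proj₁ (IsPrefix-∷-drop w i pyi)) (sym (proj₁ (IsPrefix-∷-drop w s py))))

LZPhrase-copy : ∀ {w s i₀} n → 0 < n → n + s ≤ length w → i₀ < s → factor w i₀ n ≡ factor w s n →
                (∀ i → i < s → suc n + s ≤ length w → factor w i (suc n) ≢ factor w s (suc n)) →
                LZPhrase w s (factor w s n)
LZPhrase-copy {w} {s} {i₀} n 0<n n+s≤|w| i₀<s same unextendable =
  factor-IsPrefix w s n n+s≤|w| , inj₁ (nonempty , (i₀ , i₀<s , earlier) , longest)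
  where
  nonempty : 0 < length (factor w s n)
  nonempty = subst (0 <_) (sym (length-factor w s n)) 0<n

  earlier : IsPrefix (factor w s n) (drop i₀ w)
  earlier = subst (λ x → IsPrefix x (drop i₀ w)) same
                  (factor-IsPrefix w i₀ n (≤-trans (+-monoʳ-≤ n (<⇒≤ i₀<s)) n+s≤|w|))

  longest : ∀ y → IsPrefix y (drop s w) → length (factor w s n) < length y → ¬ OccursBefore w s y
  longest y py longer (i , i<s , pyi) =
    unextendable i i<s (≤-trans (+-monoˡ-≤ s n<|y|) (IsPrefix-drop-length w s py (≤-<-trans z≤n n<|y|)))
                 (factor-shorten n<|y| agree)
    where
    n<|y| : n < length y
    n<|y| = subst (_< length y) (length-factor w s n) longer
    agree : factor w i (length y) ≡ factor w s (length y)
    agree = trans (sym (IsPrefix⇒factor w i y pyi)) (IsPrefix⇒factor w s y py)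

-- Unlike 2 * n, double (suc n) reduces to suc (suc (double n)), which the phrase positions rely on.
double : ℕ → ℕ
double zero    = zero
double (suc n) = suc (suc (double n))

double≡2* : ∀ n → double n ≡ 2 * n
double≡2* zero    = refl
double≡2* (suc n) = cong suc (trans (cong suc (double≡2* n)) (sym (+-suc n (n + 0))))

double-mono-≤ : ∀ {a b} → a ≤ b → double a ≤ double b
double-mono-≤ z≤n       = z≤n
double-mono-≤ (s≤s a≤b) = s≤s (s≤s (double-mono-≤ a≤b))

⌊double/2⌋ : ∀ j → ⌊ double j /2⌋ ≡ j
⌊double/2⌋ zero    = refl
⌊double/2⌋ (suc j) = cong suc (⌊double/2⌋ j)

⌈double/2⌉ : ∀ j → ⌈ double j /2⌉ ≡ j
⌈double/2⌉ zero    = refl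
⌈double/2⌉ (suc j) = cong suc (⌈double/2⌉ j)

ascending : ℕ → ℕ → Str
ascending c zero    = []
ascending c (suc n) = c ∷ ascending (suc c) n

pairs : List ℕ → Str
pairs js = concat (map (λ j → suc j ∷ suc (suc j) ∷ []) js)

length-pairs : ∀ js → length (pairs js) ≡ double (length js)
length-pairs []       = refl
length-pairs (_ ∷ js) = cong (λ n → suc (suc n)) (length-pairs js)

-- Stated for every g pointwise equal to (o +_), since applyUpTo recurses on g ∘ suc.
nth-pairs-applyUpTo : ∀ {g : ℕ → ℕ} {o} n {i} → (∀ j → g j ≡ o + j) → i < double n →
                      nth (pairs (applyUpTo g n)) i ≡ suc (o + ⌈ i /2⌉)
nth-pairs-applyUpTo {g} {o} (suc n) {zero}        g≡o+ _ = cong suc (g≡o+ 0)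
nth-pairs-applyUpTo {g} {o} (suc n) {suc zero}    g≡o+ _ =
  cong suc (trans (cong suc (g≡o+ 0)) (sym (+-suc o 0)))
nth-pairs-applyUpTo {g} {o} (suc n) {suc (suc i)} g≡o+ (s≤s (s≤s i<2n)) =
  trans (nth-pairs-applyUpTo n (λ j → trans (g≡o+ (suc j)) (+-suc o j)) i<2n)
        (cong suc (sym (+-suc o ⌈ i /2⌉)))

module Word (m : ℕ) where

  w : Str
  w = wσ (suc m)

  length-pairs-w : length (pairs (upTo m)) ≡ double m
  length-pairs-w = trans (length-pairs (upTo m)) (cong double (length-upTo m))

  length-w : length w ≡ suc m + double m
  length-w = begin
    length w                                                     ≡⟨ length-++ (pairs (upTo m)) ⟩
    length (pairs (upTo m)) + length (map suc (upTo (suc m)))    ≡⟨ cong₂ _+_ length-pairs-w |run| ⟩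
    double m + suc m                                             ≡⟨ +-comm (double m) (suc m) ⟩
    suc m + double m                                             ∎
    where
    open ≡-Reasoning
    |run| : length (map suc (upTo (suc m))) ≡ suc m
    |run| = trans (length-map suc (upTo (suc m))) (length-upTo (suc m))

  pairs-<-length : ∀ {i} → i < double m → i < length w
  pairs-<-length i<2m = ≤-trans i<2m (subst (double m ≤_) (sym length-w) (m≤n+m (double m) (suc m)))

  nth-pairs : ∀ {i} → i < double m → nth w i ≡ suc ⌈ i /2⌉
  nth-pairs {i} i<2m =
    trans (nth-++ˡ (pairs (upTo m)) _ (subst (i <_) (sym length-pairs-w) i<2m))
          (nth-pairs-applyUpTo m (λ _ → refl) i<2m)

  nth-run : ∀ {q} → q < suc m → nth w (q + double m) ≡ suc q
  nth-run {q} q<σ = begin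
    nth w (q + double m)                                   ≡⟨ cong (nth w) position ⟩
    nth w (length (pairs (upTo m)) + q)                    ≡⟨ nth-++ʳ (pairs (upTo m)) _ q ⟩
    nth (map suc (upTo (suc m))) q                         ≡⟨ cong (λ xs → nth xs q) (map-applyUpTo (λ k → k) suc (suc m)) ⟩
    nth (applyUpTo suc (suc m)) q                          ≡⟨ nth-applyUpTo suc q<σ ⟩
    suc q                                                  ∎
    where
    open ≡-Reasoning
    position : q + double m ≡ length (pairs (upTo m)) + q
    position = trans (+-comm q (double m)) (cong (_+ q) (sym length-pairs-w))

  nth-even : ∀ {j} → j < m → nth w (double j) ≡ suc j
  nth-even {j} j<m = trans (nth-pairs (<⇒≤ (double-mono-≤ j<m))) (cong suc (⌈double/2⌉ j))

  nth-odd : ∀ {j} → j < m → nth w (suc (double j)) ≡ suc (suc j)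
  nth-odd {j} j<m = trans (nth-pairs (double-mono-≤ j<m)) (cong (λ k → suc (suc k)) (⌊double/2⌋ j))

  nth-pairs-≤ : ∀ {i j} → j < m → i ≤ double j → nth w i ≤ suc j
  nth-pairs-≤ {i} {j} j<m i≤2j = begin
    nth w i             ≡⟨ nth-pairs (≤-<-trans i≤2j (<⇒≤ (double-mono-≤ j<m))) ⟩
    suc ⌈ i /2⌉         ≤⟨ s≤s (⌈n/2⌉-mono i≤2j) ⟩
    suc ⌈ double j /2⌉  ≡⟨ cong suc (⌈double/2⌉ j) ⟩
    suc j               ∎
    where open ≤-Reasoning

  factor-pairs : ∀ {q} → q < m → factor w (double q) 2 ≡ ascending (suc q) 2
  factor-pairs q<m = cong₂ (λ a b → a ∷ b ∷ []) (nth-even q<m) (nth-odd q<m)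

  factor-run : ∀ {q} n → n + q ≤ suc m → factor w (q + double m) n ≡ ascending (suc q) n
  factor-run     zero    _     = refl
  factor-run {q} (suc n) n+q<σ = cong₂ _∷_ (nth-run (m+n≤o⇒n≤o n n+1+q≤σ)) (factor-run n n+1+q≤σ)
    where
    n+1+q≤σ : n + suc q ≤ suc m
    n+1+q≤σ = subst (_≤ suc m) (sym (+-suc n q)) n+q<σ

  run-start : nth w (double m) ≡ 1
  run-start = nth-run (s≤s z≤n)

  -- Two steps raise a letter of the pair part by at most one, and the run restarts at 1.
  pairs-no-ascending-trigram : ∀ {i c} → i < double m → nth w i ≡ c → nth w (suc i) ≡ suc c →
                               nth w (suc (suc i)) ≢ suc (suc c)
  pairs-no-ascending-trigram {i} i<2m first second third with m≤n⇒m<n∨m≡n i<2m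
  ... | inj₂ 1+i≡2m =
    0≢1+n (trans (suc-injective (trans (sym run-start) (trans (cong (nth w) (sym 1+i≡2m)) second)))
                 (trans (sym first) (nth-pairs i<2m)))
  ... | inj₁ 1+i<2m with m≤n⇒m<n∨m≡n 1+i<2m
  ...   | inj₂ 2+i≡2m =
    0≢1+n (suc-injective (trans (sym run-start) (trans (cong (nth w) (sym 2+i≡2m)) third)))
  ...   | inj₁ 2+i<2m =
    1+n≢n (trans (sym third) (trans (nth-pairs 2+i<2m) (cong suc (trans (sym (nth-pairs i<2m)) first))))

  ascending-trigram-not-before : ∀ {i q} → q < suc m → i < q + double m →
                                 factor w i 3 ≢ ascending (suc q) 3
  ascending-trigram-not-before {i} {q} q<σ i<s same with i <? double m
  ... | yes i<2m = pairs-no-ascending-trigram i<2m (letter 0) (letter 1) (letter 2)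
    where
    letter : ∀ k → nth (factor w i 3) k ≡ nth (ascending (suc q) 3) k
    letter k = cong (λ xs → nth xs k) same
  ... | no i≮2m = <⇒≢ p<q (suc-injective (begin
    suc p                ≡⟨ nth-run (<-trans p<q q<σ) ⟨
    nth w (p + double m) ≡⟨ cong (nth w) p+2m≡i ⟩
    nth w i              ≡⟨ cong (λ xs → nth xs 0) same ⟩
    suc q                ∎))
    where
    open ≡-Reasoning
    p : ℕ
    p = i ∸ double m
    p+2m≡i : p + double m ≡ i
    p+2m≡i = m∸n+n≡m (≮⇒≥ i≮2m)
    p<q : p < q
    p<q = +-cancelʳ-< (double m) p q (subst (_< q + double m) (sym p+2m≡i) i<s)

  fresh-odd : ∀ {j} → j < m → LZPhrase w (suc (double j)) (nth w (suc (double j)) ∷ [])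
  fresh-odd {j} j<m = LZPhrase-fresh (pairs-<-length (double-mono-≤ j<m)) unseen
    where
    unseen : ∀ i → i < suc (double j) → nth w i ≢ nth w (suc (double j))
    unseen i (s≤s i≤2j) same = <⇒≢ (s≤s (nth-pairs-≤ j<m i≤2j)) (trans same (nth-odd j<m))

  copied-even : ∀ {j} → suc j < m → LZPhrase w (double (suc j)) (nth w (double (suc j)) ∷ [])
  copied-even {j} 1+j<m =
    LZPhrase-copy {i₀ = suc (double j)} 1 (s≤s z≤n) (pairs-<-length (<⇒≤ (double-mono-≤ 1+j<m))) ≤-refl
                  (cong (_∷ []) (trans (nth-odd (<-trans (n<1+n j) 1+j<m)) (sym (nth-even 1+j<m))))
                  unextendable
    where
    unextendable : ∀ i → i < double (suc j) → 2 + double (suc j) ≤ length w →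
                   factor w i 2 ≢ factor w (double (suc j)) 2
    unextendable i i<s _ same =
      <⇒≢ (s≤s (nth-pairs-≤ 1+j<m i<s)) (trans (cong (λ xs → nth xs 1) same) (nth-odd 1+j<m))

  copied-run : ∀ {q} → 2 + q ≤ suc m → LZPhrase w (q + double m) (factor w (q + double m) 2)
  copied-run {q} 2+q≤σ =
    LZPhrase-copy {i₀ = double q} 2 (s≤s z≤n)
                  (subst (2 + q + double m ≤_) (sym length-w) (+-monoˡ-≤ (double m) 2+q≤σ))
                  (<-≤-trans (<⇒≤ (double-mono-≤ q<m)) (m≤n+m (double m) q))
                  (trans (factor-pairs q<m) (sym (factor-run 2 2+q≤σ)))
                  unextendable
    where
    q<m : q < m
    q<m = s≤s⁻¹ 2+q≤σ
    unextendable : ∀ i → i < q + double m → 3 + q + double m ≤ length w →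
                   factor w i 3 ≢ factor w (q + double m) 3
    unextendable i i<s 3+s≤|w| same =
      ascending-trigram-not-before (<-trans (n<1+n q) 2+q≤σ) i<s (trans same (factor-run 3 3+q≤σ))
      where
      3+q≤σ : 3 + q ≤ suc m
      3+q≤σ = +-cancelʳ-≤ (double m) (3 + q) (suc m) (subst (3 + q + double m ≤_) length-w 3+s≤|w|)

  run-parse : ∀ r q → double r + q ≡ suc m → Parse w (q + double m) r
  run-parse zero    q q≡σ     =
    subst (λ p → Parse w p 0) (trans length-w (cong (_+ double m) (sym q≡σ))) parse-end
  run-parse (suc r) q 2r+q≡σ =
    parse-cons (copied-run 2+q≤σ) (+-comm (q + double m) 2) (run-parse r (suc (suc q)) rest≡σ)
    where
    rest≡σ : double r + suc (suc q) ≡ suc m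
    rest≡σ = trans (+-suc (double r) (suc q)) (trans (cong suc (+-suc (double r) q)) 2r+q≡σ)
    2+q≤σ : 2 + q ≤ suc m
    2+q≤σ = subst (2 + q ≤_) rest≡σ (m≤n+m (2 + q) (double r))

  pairs-parse : ∀ {n} r j → r + suc j ≡ m → Parse w (double m) n → Parse w (double (suc j)) (double r + n)
  pairs-parse zero    j 1+j≡m   run = subst (λ p → Parse w (double p) _) (sym 1+j≡m) run
  pairs-parse (suc r) j r+2+j≡m run =
    parse-cons (copied-even 1+j<m) (+-comm _ 1)
      (parse-cons (fresh-odd 1+j<m) (+-comm _ 1)
        (pairs-parse r (suc j) (trans (+-suc r (suc j)) r+2+j≡m) run))
    where
    1+j<m : suc j < m
    1+j<m = subst (suc j <_) r+2+j≡m (s≤s (m≤n+m (suc j) r))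

wσ-parse : ∀ m h → double h ≡ suc (suc m) → Parse (wσ (suc (suc m))) 0 (double (suc m) + h)
wσ-parse m h 2h≡σ =
  parse-cons (LZPhrase-fresh (pairs-<-length (s≤s z≤n)) (λ _ ())) refl
    (parse-cons (fresh-odd (s≤s z≤n)) refl
      (pairs-parse m 0 (+-comm m 1) (run-parse h 0 (trans (+-identityʳ (double h)) 2h≡σ))))
  where open Word (suc m)

lemma4p8 : ∀ (σ : ℕ) → 2 ≤ σ → 2 ∣ σ → LZCount (wσ σ) (2 * σ + σ / 2 ∸ 2)
lemma4p8 σ@(suc (suc m)) (s≤s (s≤s _)) (divides h σ≡h*2) =
  LZCount-of-parse (subst (Parse (wσ σ) 0) phrase-count (wσ-parse m h 2h≡σ))
  where
  2h≡σ : double h ≡ σ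
  2h≡σ = trans (double≡2* h) (trans (*-comm 2 h) (sym σ≡h*2))
  σ/2≡h : σ / 2 ≡ h
  σ/2≡h = trans (cong (_/ 2) σ≡h*2) (m*n/n≡m h 2)
  -- The left side is double σ + h ∸ 2 by computation.
  phrase-count : double (suc m) + h ≡ 2 * σ + σ / 2 ∸ 2
  phrase-count = cong₂ (λ a b → a + b ∸ 2) (double≡2* σ) (sym σ/2≡h)
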